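{- Say that an integer $a\ge 2$ satisfies the Erdős–Straus property if there exist positive integers $b,c,d$ with $\frac{4}{a}=\frac{1}{b}+\frac{1}{c}+\frac{1}{d}$. Then every integer $a$ of the form $a=2q$ or $a=4q-1$ with $q\ge 1$ an integer satisfies the Erdős–Straus property. Moreover, define for positive integers $x,y,z$ the polynomials \[ p_1(x,y,z)=x(4yz-1)-yz,\quad p_2(x,y,z)=x(4yz-z-1)-yz,\quad p_3(x,y,z)=x(8y-3)-6y+2,\quad p_4(x,y,z)=x^2-x, \] and assume that every positive integer $q\ge 1$ equals $p_i(x,y,z)$ for some $i\in\{1,2,3,4\}$ and some positive integers $x,y,z$. Then every integer of the form $4q+1$ with $q\ge 1$ satisfies the Erdős–Straus property; in particular every prime of this form does.
   Context: The variables $x,y,z$ range over the positive integers. -}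

module Defs where

open import Data.Nat as ℕ using (ℕ; suc; _≥_)
open import Data.Integer using (ℤ; +_; _-_; _*_) renaming (_+_ to _+ℤ_)
open import Data.Empty using (⊥)
open import Data.Rational as ℚ using (ℚ)
open import Data.Product using (∃-syntax; _×_)
open import Data.Sum using (_⊎_)
open import Relation.Binary.PropositionalEquality using (_≡_)

-- Erdős–Straus property of an integer a ≥ 2: there are positive integers
-- b, c, d (written suc b, suc c, suc d with b c d : ℕ) such that
-- 4/a = 1/b + 1/c + 1/d in ℚ.
ErdosStraus : ℕ → Set
ErdosStraus 0 = ⊥
ErdosStraus 1 = ⊥
ErdosStraus a@(suc (suc _)) = ∃[ b ] ∃[ c ] ∃[ d ]
  ((+ 4) ℚ./ a ≡ ((+ 1) ℚ./ suc b ℚ.+ (+ 1) ℚ./ suc c) ℚ.+ (+ 1) ℚ./ suc d)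

p₁ p₂ p₃ p₄ : ℤ → ℤ → ℤ → ℤ
p₁ x y z = x * (+ 4 * y * z - + 1) - y * z
p₂ x y z = x * (+ 4 * y * z - z - + 1) - y * z
p₃ x y z = ((x * ((+ 8 * y) - + 3)) - (+ 6 * y)) +ℤ (+ 2)
p₄ x y z = x * x - x

CoveringHypothesis : Set
CoveringHypothesis = ∀ (q : ℕ) → q ≥ 1 →
  ∃[ x ] ∃[ y ] ∃[ z ] (x ≥ 1 × y ≥ 1 × z ≥ 1 ×
    (+ q ≡ p₁ (+ x) (+ y) (+ z)
    ⊎ (+ q ≡ p₂ (+ x) (+ y) (+ z)
    ⊎ (+ q ≡ p₃ (+ x) (+ y) (+ z)
    ⊎ + q ≡ p₄ (+ x) (+ y) (+ z)))))

{-# OPTIONS --safe #-}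
-- Clearing denominators, 4/n = 1/b + 1/c + 1/d becomes 4bcd = n(cd + bd + bc)
-- over ℕ, and a solution for n scales to one for every multiple of n.  A single
-- parametric family does most of the work: if nm + 1 = 4uv and u + 1 = wm, then
-- 4/n = 1/(wv) + 1/(wuv) + 1/(nuv).  It solves n = 4q + 3 and n = 8q + 5, and
-- 4/2 = 1/1 + 1/2 + 1/2 scales to every even number.  For n = 4q + 1 the covering
-- hypothesis factors n: 4p₁ + 1 = (4x − 1)(4yz − 1) and 4p₃ + 1 = (8y − 3)(4x − 3)
-- are multiples of solved numbers, 4p₂ + 1 lies in the parametric family with
-- m = 4y − 1, and 4p₄ + 1 = (2x − 1)² is the square either of a number 4k + 3 or
-- of a number 4k + 1 with k < q, which strong induction on q has already solved.
module Submission where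

open import Defs
open import Data.Nat using (ℕ; _+_; _*_; _∸_; _≥_; suc; zero; _≤_; _<_; NonZero; >-nonZero; s≤s; z≤n)
open import Data.Product using (_×_; _,_)
open import Data.Nat.Properties
  using ( module ≤-Reasoning; m*n≢0; *-identityˡ; 1+n≰n; m≤m*n; m≤n*m; m≤n+m; m<m*n
        ; +-mono-≤; *-monoˡ-≤; *-cancelʳ-≤; +-cancelʳ-≡; +-cancelʳ-<; *-cancelˡ-<)
open import Data.Nat.DivMod using (_divMod_; result)
open import Data.Nat.Induction using (<-rec)
open import Data.Nat.Tactic.RingSolver using (solve-∀)
open import Data.Fin using () renaming (zero to 0F; suc to sucF)
open import Data.Integer as ℤ using (ℤ; +_)
open import Data.Integer.Properties using (pos-*; +-injective)
import Data.Integer.Tactic.RingSolver as ℤ-Solver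
open import Data.Rational as ℚ using (toℚᵘ)
open import Data.Rational.Properties using (toℚᵘ-injective; toℚᵘ-fromℚᵘ; toℚᵘ-homo-+)
open import Data.Rational.Unnormalised as ℚᵘ using (mkℚᵘ; *≡*)
open import Data.Rational.Unnormalised.Properties using (+-cong; ≃-refl; module ≃-Reasoning)
open import Data.Sum using (inj₁; inj₂)
open import Relation.Nullary using (¬_)
open import Relation.Binary.PropositionalEquality

record Solution (n : ℕ) : Set where
  constructor solution
  field
    b c d : ℕ
    .{{b≢0}} : NonZero b
    .{{c≢0}} : NonZero c
    .{{d≢0}} : NonZero d
    identity : 4 * (b * c * d) ≡ n * (c * d + b * d + b * c)

4/n≡1/b+1/c+1/d : ∀ n b c d →
                  .{{_ : NonZero n}} .{{_ : NonZero b}} .{{_ : NonZero c}} .{{_ : NonZero d}} →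
                  4 * (b * c * d) ≡ n * (c * d + b * d + b * c) →
                  + 4 ℚ./ n ≡ (+ 1 ℚ./ b ℚ.+ + 1 ℚ./ c) ℚ.+ + 1 ℚ./ d
4/n≡1/b+1/c+1/d n@(suc n-1) b@(suc b-1) c@(suc c-1) d@(suc d-1) eq = toℚᵘ-injective (begin
  toℚᵘ (+ 4 ℚ./ n)                                          ≈⟨ toℚᵘ-/ (+ 4) n-1 ⟩
  mkℚᵘ (+ 4) n-1                                            ≈⟨ *≡* (cong +_ cross-multiplied) ⟩
  (mkℚᵘ (+ 1) b-1 ℚᵘ.+ mkℚᵘ (+ 1) c-1) ℚᵘ.+ mkℚᵘ (+ 1) d-1
    ≈⟨ +-cong (+-cong (toℚᵘ-/ (+ 1) b-1) (toℚᵘ-/ (+ 1) c-1)) (toℚᵘ-/ (+ 1) d-1) ⟨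
  (toℚᵘ (+ 1 ℚ./ b) ℚᵘ.+ toℚᵘ (+ 1 ℚ./ c)) ℚᵘ.+ toℚᵘ (+ 1 ℚ./ d)
    ≈⟨ +-cong (toℚᵘ-homo-+ (+ 1 ℚ./ b) (+ 1 ℚ./ c)) ≃-refl ⟨
  toℚᵘ (+ 1 ℚ./ b ℚ.+ + 1 ℚ./ c) ℚᵘ.+ toℚᵘ (+ 1 ℚ./ d)
    ≈⟨ toℚᵘ-homo-+ (+ 1 ℚ./ b ℚ.+ + 1 ℚ./ c) (+ 1 ℚ./ d) ⟨
  toℚᵘ ((+ 1 ℚ./ b ℚ.+ + 1 ℚ./ c) ℚ.+ + 1 ℚ./ d)            ∎)
  where
  open ≃-Reasoning
  toℚᵘ-/ : ∀ i m → toℚᵘ (i ℚ./ suc m) ℚᵘ.≃ mkℚᵘ i m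
  toℚᵘ-/ i m = toℚᵘ-fromℚᵘ (mkℚᵘ i m)
  reorder : ∀ n b c d → n * (c * d + b * d + b * c) ≡ ((1 * c + 1 * b) * d + 1 * (b * c)) * n
  reorder = solve-∀
  cross-multiplied : 4 * (b * c * d) ≡ ((1 * c + 1 * b) * d + 1 * (b * c)) * n
  cross-multiplied = trans eq (reorder n b c d)

¬Solution-1 : ¬ Solution 1
¬Solution-1 (solution b c d eq) = 1+n≰n (*-cancelʳ-≤ 4 3 (b * c * d) {{bcd≢0}} 4bcd≤3bcd)
  where
  open ≤-Reasoning
  bcd≢0 : NonZero (b * c * d)
  bcd≢0 = m*n≢0 (b * c) d {{m*n≢0 b c}}
  triple : ∀ m → m + m + m ≡ 3 * m
  triple = solve-∀
  4bcd≤3bcd : 4 * (b * c * d) ≤ 3 * (b * c * d)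
  4bcd≤3bcd = begin
    4 * (b * c * d)                    ≡⟨ eq ⟩
    1 * (c * d + b * d + b * c)        ≡⟨ *-identityˡ _ ⟩
    c * d + b * d + b * c              ≤⟨ +-mono-≤ (+-mono-≤ (*-monoˡ-≤ d (m≤n*m c b))
                                                             (*-monoˡ-≤ d (m≤m*n b c)))
                                                   (m≤m*n (b * c) d) ⟩
    b * c * d + b * c * d + b * c * d  ≡⟨ triple (b * c * d) ⟩
    3 * (b * c * d)                    ∎

Solution⇒ErdosStraus : ∀ {n} → Solution n → ErdosStraus n
Solution⇒ErdosStraus {0} (solution (suc _) (suc _) (suc _) ())
Solution⇒ErdosStraus {1} s = ¬Solution-1 s
Solution⇒ErdosStraus {n@(suc (suc _))} (solution (suc b) (suc c) (suc d) eq) =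
  b , c , d , 4/n≡1/b+1/c+1/d n (suc b) (suc c) (suc d) eq

solution-* : ∀ {n} k .{{_ : NonZero k}} → Solution n → Solution (n * k)
solution-* {n} k (solution b c d eq) =
  solution (b * k) (c * k) (d * k) {{m*n≢0 b k}} {{m*n≢0 c k}} {{m*n≢0 d k}} (begin
    4 * (b * k * (c * k) * (d * k))                                ≡⟨ cube b c d k ⟩
    k * k * k * (4 * (b * c * d))                                  ≡⟨ cong (k * k * k *_) eq ⟩
    k * k * k * (n * (c * d + b * d + b * c))                      ≡⟨ cube′ n b c d k ⟩
    n * k * (c * k * (d * k) + b * k * (d * k) + b * k * (c * k))  ∎)
  where
  open ≡-Reasoning
  cube : ∀ b c d k → 4 * (b * k * (c * k) * (d * k)) ≡ k * k * k * (4 * (b * c * d))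
  cube = solve-∀
  cube′ : ∀ n b c d k → k * k * k * (n * (c * d + b * d + b * c)) ≡
                        n * k * (c * k * (d * k) + b * k * (d * k) + b * k * (c * k))
  cube′ = solve-∀

-- 1/(wv) + 1/(wuv) = (u + 1)/(wuv) = m/(uv), and m/(uv) + 1/(nuv) = (nm + 1)/(nuv) = 4/n.
nm+1≡4uv⇒Solution : ∀ n m u v w →
                    .{{_ : NonZero n}} .{{_ : NonZero u}} .{{_ : NonZero v}} .{{_ : NonZero w}} →
                    n * m + 1 ≡ 4 * (u * v) → u + 1 ≡ w * m → Solution n
nm+1≡4uv⇒Solution n m u v w nm+1≡4uv u+1≡wm =
  solution (w * v) (w * u * v) (n * u * v)
    {{m*n≢0 w v}} {{m*n≢0 (w * u) v {{m*n≢0 w u}}}} {{m*n≢0 (n * u) v {{m*n≢0 n u}}}} (begin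
    4 * (w * v * (w * u * v) * (n * u * v))       ≡⟨ collect n u v w ⟩
    n * (w * w * u * v * v) * (4 * (u * v))       ≡⟨ cong (n * (w * w * u * v * v) *_) nm+1≡4uv ⟨
    n * (w * w * u * v * v) * (n * m + 1)         ≡⟨ regroup n m u v w ⟩
    n * (w * u * v * v) * (n * (w * m) + w)       ≡⟨ cong (λ t → n * (w * u * v * v) * (n * t + w)) u+1≡wm ⟨
    n * (w * u * v * v) * (n * (u + 1) + w)       ≡⟨ expand n u v w ⟩
    n * (w * u * v * (n * u * v) + w * v * (n * u * v) + w * v * (w * u * v)) ∎)
  where
  open ≡-Reasoning
  collect : ∀ n u v w → 4 * (w * v * (w * u * v) * (n * u * v)) ≡ n * (w * w * u * v * v) * (4 * (u * v))
  collect = solve-∀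
  regroup : ∀ n m u v w → n * (w * w * u * v * v) * (n * m + 1) ≡ n * (w * u * v * v) * (n * (w * m) + w)
  regroup = solve-∀
  expand : ∀ n u v w → n * (w * u * v * v) * (n * (u + 1) + w) ≡
                       n * (w * u * v * (n * u * v) + w * v * (n * u * v) + w * v * (w * u * v))
  expand = solve-∀

solution-2 : Solution 2
solution-2 = solution 1 2 2 refl

solution-4q+3 : ∀ q → Solution (3 + 4 * q)
solution-4q+3 q = nm+1≡4uv⇒Solution (3 + 4 * q) 1 (1 + q) 1 (2 + q) (eq₁ q) (eq₂ q)
  where
  eq₁ : ∀ q → (3 + 4 * q) * 1 + 1 ≡ 4 * ((1 + q) * 1)
  eq₁ = solve-∀
  eq₂ : ∀ q → 1 + q + 1 ≡ (2 + q) * 1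
  eq₂ = solve-∀

solution-8q+5 : ∀ q → Solution (5 + 8 * q)
solution-8q+5 q = nm+1≡4uv⇒Solution (5 + 8 * q) 3 (2 + 3 * q) 2 (1 + q) (eq₁ q) (eq₂ q)
  where
  eq₁ : ∀ q → (5 + 8 * q) * 3 + 1 ≡ 4 * ((2 + 3 * q) * 2)
  eq₁ = solve-∀
  eq₂ : ∀ q → 2 + 3 * q + 1 ≡ (1 + q) * 3
  eq₂ = solve-∀

-- n₂ x y z = 4 p₂(1 + x, 1 + y, 1 + z) + 1
n₂ : ℕ → ℕ → ℕ → ℕ
n₂ x y z = 5 + 8 * x + 12 * y + 8 * z + 16 * x * y + 12 * x * z + 12 * y * z + 16 * x * y * z

solution-n₂ : ∀ x y z → Solution (n₂ x y z)
solution-n₂ x y z = nm+1≡4uv⇒Solution (n₂ x y z) (3 + 4 * y) u v (1 + z) (eq₁ x y z) (eq₂ y z)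
  where
  u v : ℕ
  u = 2 + 4 * y + 3 * z + 4 * y * z
  v = 2 + 3 * x + 3 * y + 4 * x * y
  eq₁ : ∀ x y z → (5 + 8 * x + 12 * y + 8 * z + 16 * x * y + 12 * x * z + 12 * y * z + 16 * x * y * z)
                    * (3 + 4 * y) + 1
                  ≡ 4 * ((2 + 4 * y + 3 * z + 4 * y * z) * (2 + 3 * x + 3 * y + 4 * x * y))
  eq₁ = solve-∀
  eq₂ : ∀ y z → 2 + 4 * y + 3 * z + 4 * y * z + 1 ≡ (1 + z) * (3 + 4 * y)
  eq₂ = solve-∀

-- The pᵢ involve subtraction, so their identities are proved by the ℤ ring solver; a
-- ℕ-polynomial given as an Expr can be evaluated on both sides and carried back to ℕ.
infixl 6 _:+_
infixl 7 _:*_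

data Expr : Set where
  lit : ℕ → Expr
  _:+_ _:*_ : Expr → Expr → Expr

⟦_⟧ : Expr → ℕ
⟦ lit n ⟧  = n
⟦ e :+ f ⟧ = ⟦ e ⟧ + ⟦ f ⟧
⟦ e :* f ⟧ = ⟦ e ⟧ * ⟦ f ⟧

⟦_⟧ℤ : Expr → ℤ
⟦ lit n ⟧ℤ  = + n
⟦ e :+ f ⟧ℤ = ⟦ e ⟧ℤ ℤ.+ ⟦ f ⟧ℤ
⟦ e :* f ⟧ℤ = ⟦ e ⟧ℤ ℤ.* ⟦ f ⟧ℤ

+⟦e⟧≡⟦e⟧ℤ : ∀ e → + ⟦ e ⟧ ≡ ⟦ e ⟧ℤ
+⟦e⟧≡⟦e⟧ℤ (lit n)  = refl
+⟦e⟧≡⟦e⟧ℤ (e :+ f) = cong₂ ℤ._+_ (+⟦e⟧≡⟦e⟧ℤ e) (+⟦e⟧≡⟦e⟧ℤ f)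
+⟦e⟧≡⟦e⟧ℤ (e :* f) = trans (pos-* ⟦ e ⟧ ⟦ f ⟧) (cong₂ ℤ._*_ (+⟦e⟧≡⟦e⟧ℤ e) (+⟦e⟧≡⟦e⟧ℤ f))

4q+1≡⟦e⟧ : ∀ {q i} e → + q ≡ i → + 4 ℤ.* i ℤ.+ + 1 ≡ ⟦ e ⟧ℤ → 4 * q + 1 ≡ ⟦ e ⟧
4q+1≡⟦e⟧ {q} e refl 4i+1≡e = +-injective (begin
  + (4 * q + 1)        ≡⟨ +⟦e⟧≡⟦e⟧ℤ (lit 4 :* lit q :+ lit 1) ⟩
  + 4 ℤ.* + q ℤ.+ + 1  ≡⟨ 4i+1≡e ⟩
  ⟦ e ⟧ℤ               ≡⟨ +⟦e⟧≡⟦e⟧ℤ e ⟨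
  + ⟦ e ⟧              ∎)
  where open ≡-Reasoning

-- Writing the positive variables as suc x, suc y, suc z makes every factor below
-- a polynomial with nonnegative coefficients.  The pᵢ are spelled out in the ℤ
-- identities because the ring solver does not unfold definitions.
4p₁+1≡ : ∀ {q} x y z → + q ≡ p₁ (+ suc x) (+ suc y) (+ suc z) →
         4 * q + 1 ≡ (3 + 4 * x) * (3 + 4 * (y * z + y + z))
4p₁+1≡ x y z q≡p₁ =
  4q+1≡⟦e⟧ ((lit 3 :+ lit 4 :* lit x) :* (lit 3 :+ lit 4 :* (lit y :* lit z :+ lit y :+ lit z)))
           q≡p₁ (factorise (+ x) (+ y) (+ z))
  where
  factorise : ∀ x y z →
    + 4 ℤ.* ((+ 1 ℤ.+ x) ℤ.* (+ 4 ℤ.* (+ 1 ℤ.+ y) ℤ.* (+ 1 ℤ.+ z) ℤ.- + 1) ℤ.- (+ 1 ℤ.+ y) ℤ.* (+ 1 ℤ.+ z))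
      ℤ.+ + 1
    ≡ (+ 3 ℤ.+ + 4 ℤ.* x) ℤ.* (+ 3 ℤ.+ + 4 ℤ.* (y ℤ.* z ℤ.+ y ℤ.+ z))
  factorise = ℤ-Solver.solve-∀

4p₂+1≡ : ∀ {q} x y z → + q ≡ p₂ (+ suc x) (+ suc y) (+ suc z) → 4 * q + 1 ≡ n₂ x y z
4p₂+1≡ x y z q≡p₂ =
  4q+1≡⟦e⟧ (lit 5 :+ lit 8 :* lit x :+ lit 12 :* lit y :+ lit 8 :* lit z :+ lit 16 :* lit x :* lit y
              :+ lit 12 :* lit x :* lit z :+ lit 12 :* lit y :* lit z :+ lit 16 :* lit x :* lit y :* lit z)
           q≡p₂ (expand (+ x) (+ y) (+ z))
  where
  expand : ∀ x y z →
    + 4 ℤ.* ((+ 1 ℤ.+ x) ℤ.* (+ 4 ℤ.* (+ 1 ℤ.+ y) ℤ.* (+ 1 ℤ.+ z) ℤ.- (+ 1 ℤ.+ z) ℤ.- + 1)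
               ℤ.- (+ 1 ℤ.+ y) ℤ.* (+ 1 ℤ.+ z))
      ℤ.+ + 1
    ≡ + 5 ℤ.+ + 8 ℤ.* x ℤ.+ + 12 ℤ.* y ℤ.+ + 8 ℤ.* z ℤ.+ + 16 ℤ.* x ℤ.* y
        ℤ.+ + 12 ℤ.* x ℤ.* z ℤ.+ + 12 ℤ.* y ℤ.* z ℤ.+ + 16 ℤ.* x ℤ.* y ℤ.* z
  expand = ℤ-Solver.solve-∀

4p₃+1≡ : ∀ {q} x y z → + q ≡ p₃ (+ suc x) (+ suc y) (+ suc z) → 4 * q + 1 ≡ (5 + 8 * y) * (1 + 4 * x)
4p₃+1≡ x y z q≡p₃ =
  4q+1≡⟦e⟧ ((lit 5 :+ lit 8 :* lit y) :* (lit 1 :+ lit 4 :* lit x)) q≡p₃ (factorise (+ x) (+ y))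
  where
  factorise : ∀ x y →
    + 4 ℤ.* (((+ 1 ℤ.+ x) ℤ.* ((+ 8 ℤ.* (+ 1 ℤ.+ y)) ℤ.- + 3) ℤ.- (+ 6 ℤ.* (+ 1 ℤ.+ y))) ℤ.+ + 2) ℤ.+ + 1
    ≡ (+ 5 ℤ.+ + 8 ℤ.* y) ℤ.* (+ 1 ℤ.+ + 4 ℤ.* x)
  factorise = ℤ-Solver.solve-∀

4p₄+1≡ : ∀ {q} x y z → + q ≡ p₄ (+ suc x) (+ suc y) (+ suc z) → 4 * q + 1 ≡ (1 + 2 * x) * (1 + 2 * x)
4p₄+1≡ x y z q≡p₄ =
  4q+1≡⟦e⟧ ((lit 1 :+ lit 2 :* lit x) :* (lit 1 :+ lit 2 :* lit x)) q≡p₄ (factorise (+ x))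
  where
  factorise : ∀ x →
    + 4 ℤ.* ((+ 1 ℤ.+ x) ℤ.* (+ 1 ℤ.+ x) ℤ.- (+ 1 ℤ.+ x)) ℤ.+ + 1
    ≡ (+ 1 ℤ.+ + 2 ℤ.* x) ℤ.* (+ 1 ℤ.+ + 2 ℤ.* x)
  factorise = ℤ-Solver.solve-∀

solution-odd² : ∀ {q} x → q ≥ 1 → 4 * q + 1 ≡ (1 + 2 * x) * (1 + 2 * x) →
                (∀ {k} → k < q → k ≥ 1 → Solution (4 * k + 1)) → Solution (4 * q + 1)
solution-odd² {suc q} x (s≤s z≤n) eq rec with x divMod 2
... | result k (sucF 0F) refl =
  subst Solution (sym (trans eq (odd-x k))) (solution-* (3 + 4 * k) (solution-4q+3 k))
  where
  odd-x : ∀ k → (1 + 2 * (1 + k * 2)) * (1 + 2 * (1 + k * 2)) ≡ (3 + 4 * k) * (3 + 4 * k)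
  odd-x = solve-∀
... | result zero 0F refl with () ← +-cancelʳ-≡ 1 (4 * suc q) 0 eq
... | result k@(suc _) 0F refl = subst Solution (sym 4q+1≡n*n) (solution-* n (rec k<q (s≤s z≤n)))
  where
  n : ℕ
  n = 4 * k + 1
  even-x : ∀ k → (1 + 2 * (k * 2)) * (1 + 2 * (k * 2)) ≡ (4 * k + 1) * (4 * k + 1)
  even-x = solve-∀
  4q+1≡n*n : 4 * suc q + 1 ≡ n * n
  4q+1≡n*n = trans eq (even-x k)
  k<q : k < suc q
  k<q = *-cancelˡ-< 4 k (suc q) (+-cancelʳ-< 1 (4 * k) (4 * suc q)
          (subst (n <_) (sym 4q+1≡n*n) (m<m*n n n (s≤s (m≤n+m 1 _)))))

module _ (cover : CoveringHypothesis) where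

  solution-4q+1 : ∀ q → q ≥ 1 → Solution (4 * q + 1)
  solution-4q+1 = <-rec _ step
    where
    step : ∀ q → (∀ {k} → k < q → k ≥ 1 → Solution (4 * k + 1)) → q ≥ 1 → Solution (4 * q + 1)
    step q rec q≥1 with cover q q≥1
    ... | zero  , _     , _     , () , _
    ... | suc _ , zero  , _     , _  , () , _
    ... | suc _ , suc _ , zero  , _  , _  , () , _
    ... | suc x , suc y , suc z , _  , _  , _  , inj₁ q≡p₁ =
      subst Solution (sym (4p₁+1≡ x y z q≡p₁)) (solution-* (3 + 4 * (y * z + y + z)) (solution-4q+3 x))
    ... | suc x , suc y , suc z , _  , _  , _  , inj₂ (inj₁ q≡p₂) =
      subst Solution (sym (4p₂+1≡ x y z q≡p₂)) (solution-n₂ x y z)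
    ... | suc x , suc y , suc z , _  , _  , _  , inj₂ (inj₂ (inj₁ q≡p₃)) =
      subst Solution (sym (4p₃+1≡ x y z q≡p₃)) (solution-* (1 + 4 * x) (solution-8q+5 y))
    ... | suc x , suc y , suc z , _  , _  , _  , inj₂ (inj₂ (inj₂ q≡p₄)) =
      solution-odd² x q≥1 (4p₄+1≡ x y z q≡p₄) rec

solution-4q-1 : ∀ q → q ≥ 1 → Solution (4 * q ∸ 1)
solution-4q-1 (suc q) _ = subst Solution (4q+3≡ q) (solution-4q+3 q)
  where
  4q+3≡ : ∀ q → 3 + 4 * q ≡ q + 3 * (1 + q)
  4q+3≡ = solve-∀

theorem4 : ((q : ℕ) → q ≥ 1 → ErdosStraus (2 * q) × ErdosStraus (4 * q ∸ 1))
    × (CoveringHypothesis → (q : ℕ) → q ≥ 1 → ErdosStraus (4 * q + 1))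
theorem4 =
  (λ q q≥1 → Solution⇒ErdosStraus (solution-* q {{>-nonZero q≥1}} solution-2)
           , Solution⇒ErdosStraus (solution-4q-1 q q≥1)) ,
  (λ cover q q≥1 → Solution⇒ErdosStraus (solution-4q+1 cover q q≥1))
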